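{- There is a natural transformation $\eta\colon\mathrm{id}_{\mathbf{EED}}\to\mathcal R\mathcal L$ whose component at an elementary existential doctrine $P\colon\mathcal C^{op}\to\mathbf{InfSL}$ is $\eta_P=(\Gamma_P,P\rho)\colon P\to\mathcal R\mathcal L(P)$, where $\Gamma_P\colon\mathcal C\to\mathrm{Map}(\mathcal A_P)$ is the graph functor and $(P\rho)_X=P_{\rho_X}\colon P(X)\to P(X\times I)=\mathcal R\mathcal L(P)(X)$, with $\rho_X\colon X\times I\to X$ the right unitor of $\mathcal C$.
   Context: Composition diagrammatic ($;$). Cartesian category: chosen products $\times$, projections $\pi_i$, pairing, terminal $I$, diagonals $\Delta_A$, unique maps $!_A$, unitor $\rho_X$. $\mathbf{InfSL}$: meet-semilattices with top, finite-meet-preserving maps; $P_f=P(f)$. Elementary existential doctrine: $P\colon\mathcal C^{op}\to\mathbf{InfSL}$ with $\delta_A\in P(A\times A)$ such that for $e=\mathrm{id}_X\times\Delta_A$, $P_e$ has left adjoint $\exists_e(\alpha)=P_{\langle\pi_1,\pi_2\rangle}(\alpha)\wedge P_{\langle\pi_2,\pi_3\rangle}(\delta_A)$, and $P_\pi$ has a left adjoint $\exists_\pi$ for each product projection $\pi$, satisfying Beck–Chevalley along pullbacks of projections and Frobenius reciprocity. $\mathbf{EED}$: morphisms $(F,b)\colon P\to R$, $F$ strict cartesian (preserves chosen products/terminal on the nose), $b\colon P\to R\circ F^{op}$ natural with $b_{A\times A}(\delta^P_A)=\delta^R_{FA}$ and $b_A\circ\exists^P_\pi=\exists^R_{F\pi}\circ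 b_{X\times A}$ for projections $\pi\colon X\times A\to A$; composition $(G,c)\circ(F,b)=(GF,cF\circ b)$. Cartesian bicategory: poset-enriched symmetric monoidal $(\mathcal B,\otimes,I)$ with cocommutative comonoids $d_X,e_X$ having right adjoints $d^*_X,e^*_X$, satisfying Frobenius $(d_X\otimes\mathrm{id});(\mathrm{id}\otimes d^*_X)=d^*_X;d_X$, with every $R$ a lax comonoid homomorphism ($R;d_Y\le d_X;(R\otimes R)$, $R;e_Y\le e_X$) and comonoids coherent with $\otimes$. Maps: $f$ with $f;d_Y=d_X;(f\otimes f)$, $f;e_Y=e_X$, forming cartesian $\mathrm{Map}(\mathcal B)$. $\mathbf{CBC}$: strict monoidal functors preserving order and $d,e,d^*,e^*$. $\mathcal R(\mathcal B)=\mathrm{Hom}_{\mathcal B}(-,I)\colon\mathrm{Map}(\mathcal B)^{op}\to\mathbf{InfSL}$, $f\mapsto(U\mapsto f;U)$; $\mathcal R(F)=(F\restriction_{\mathrm{Map}},U\mapsto F(U))$. $\mathcal L(P)=\mathcal A_P$: objects of $\mathcal C$, $\mathrm{Hom}(X,Y)=P(X\times Y)$, identity $\delta_X$, composite $\exists_{\langle\pi_1,\pi_3\rangle}(P_{\langle\pi_1,\pi_2\rangle}f\wedge P_{\langle\pi_2,\pi_3\rangle}g)$, tensor $P_{\langle\pi_1,\pi_3\rangle}f\wedge P_{\langle\pi_2,\pi_4\rangle}g$, with symmetry, unitors and comonoids ($\Gamma_P(\Delta_X),\Gamma_P(!_X)$) transported along the graph functor $\Gamma_P(f)=P_{f\times\mathrm{id}_Y}(\delta_Y)$,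 which is a strict cartesian functor $\mathcal C\to\mathrm{Map}(\mathcal A_P)$; $\mathcal L(F,b)$ sends $r\in P(X\times Y)$ to $b_{X\times Y}(r)$. Hence $\mathcal R\mathcal L(P)=\mathrm{Hom}_{\mathcal A_P}(-,I)=P(-\times I)\colon\mathrm{Map}(\mathcal A_P)^{op}\to\mathbf{InfSL}$. -}

module Defs where

open import Level using (Level; _⊔_) renaming (suc to lsuc)
open import Relation.Binary.PropositionalEquality using (_≡_; subst)
open import Data.Product using (_×_; _,_)

_⇔_ : ∀ {a b} → Set a → Set b → Set (a ⊔ b)
A ⇔ B = (A → B) × (B → A)

-- Composition is diagrammatic (f ⨾ g = "f then g").

record Doctrine (o m p : Level) : Set (lsuc (o ⊔ m ⊔ p)) where
  infixr 9 _⨾_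
  infixr 6 _∧_
  infixr 7 _⊗_
  field
    Obj   : Set o
    Hom   : Obj → Obj → Set m
    _≈_   : ∀ {A B} → Hom A B → Hom A B → Set m
    id    : ∀ {A} → Hom A A
    _⨾_   : ∀ {A B C} → Hom A B → Hom B C → Hom A C
    _⊗_   : Obj → Obj → Obj
    𝟙     : Obj
    π₁    : ∀ {A B} → Hom (A ⊗ B) A
    π₂    : ∀ {A B} → Hom (A ⊗ B) B
    ⟨_,_⟩ : ∀ {C A B} → Hom C A → Hom C B → Hom C (A ⊗ B)
    !     : ∀ {A} → Hom A 𝟙
    Fib   : Obj → Set p
    _≤_   : ∀ {A} → Fib A → Fib A → Set p
    top   : ∀ {A} → Fib A
    _∧_   : ∀ {A} → Fib A → Fib A → Fib A
    re    : ∀ {A B} → Hom A B → Fib B → Fib A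
    δ     : ∀ A → Fib (A ⊗ A)
    Ex    : ∀ {X A} → Fib (X ⊗ A) → Fib A
    Ex₁   : ∀ {X A} → Fib (X ⊗ A) → Fib X

  _×₁_ : ∀ {A B C D} → Hom A C → Hom B D → Hom (A ⊗ B) (C ⊗ D)
  f ×₁ g = ⟨ π₁ ⨾ f , π₂ ⨾ g ⟩

  Δ : ∀ {A} → Hom A (A ⊗ A)
  Δ = ⟨ id , id ⟩

  ρ : ∀ {X} → Hom (X ⊗ 𝟙) X
  ρ = π₁

  -- the left adjoint candidate ∃_e for e = id_X × Δ_A : X×A → X×(A×A)
  exE : ∀ {X A} → Fib (X ⊗ A) → Fib (X ⊗ (A ⊗ A))
  exE {X} {A} α = re ⟨ π₁ , π₂ ⨾ π₁ ⟩ α ∧ re ⟨ π₂ ⨾ π₁ , π₂ ⨾ π₂ ⟩ (δ A)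

record IsEED {o m p} (D : Doctrine o m p) : Set (o ⊔ m ⊔ p) where
  open Doctrine D
  field
    ≈-refl  : ∀ {A B} {f : Hom A B} → f ≈ f
    ≈-sym   : ∀ {A B} {f g : Hom A B} → f ≈ g → g ≈ f
    ≈-trans : ∀ {A B} {f g h : Hom A B} → f ≈ g → g ≈ h → f ≈ h
    ⨾-cong  : ∀ {A B C} {f f' : Hom A B} {g g' : Hom B C} →
              f ≈ f' → g ≈ g' → (f ⨾ g) ≈ (f' ⨾ g')
    ⟨⟩-cong : ∀ {C A B} {f f' : Hom C A} {g g' : Hom C B} →
              f ≈ f' → g ≈ g' → ⟨ f , g ⟩ ≈ ⟨ f' , g' ⟩
    assoc   : ∀ {A B C D} (f : Hom A B) (g : Hom B C) (h : Hom C D) →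
              ((f ⨾ g) ⨾ h) ≈ (f ⨾ (g ⨾ h))
    idˡ     : ∀ {A B} (f : Hom A B) → (id ⨾ f) ≈ f
    idʳ     : ∀ {A B} (f : Hom A B) → (f ⨾ id) ≈ f
    β₁      : ∀ {C A B} (f : Hom C A) (g : Hom C B) → (⟨ f , g ⟩ ⨾ π₁) ≈ f
    β₂      : ∀ {C A B} (f : Hom C A) (g : Hom C B) → (⟨ f , g ⟩ ⨾ π₂) ≈ g
    η×      : ∀ {C A B} (h : Hom C (A ⊗ B)) → ⟨ h ⨾ π₁ , h ⨾ π₂ ⟩ ≈ h
    !-unique : ∀ {A} (f : Hom A 𝟙) → f ≈ !
    ≤-refl    : ∀ {A} {α : Fib A} → α ≤ α
    ≤-trans   : ∀ {A} {α β γ : Fib A} → α ≤ β → β ≤ γ → α ≤ γ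
    ≤-antisym : ∀ {A} {α β : Fib A} → α ≤ β → β ≤ α → α ≡ β
    ∧-lb₁     : ∀ {A} (α β : Fib A) → (α ∧ β) ≤ α
    ∧-lb₂     : ∀ {A} (α β : Fib A) → (α ∧ β) ≤ β
    ∧-glb     : ∀ {A} {α β γ : Fib A} → γ ≤ α → γ ≤ β → γ ≤ (α ∧ β)
    top-max   : ∀ {A} (α : Fib A) → α ≤ top
    re-id   : ∀ {A} (α : Fib A) → re id α ≡ α
    re-⨾    : ∀ {A B C} (f : Hom A B) (g : Hom B C) (α : Fib C) →
              re (f ⨾ g) α ≡ re f (re g α)
    re-resp : ∀ {A B} {f g : Hom A B} → f ≈ g → (α : Fib B) → re f α ≡ re g α
    re-top  : ∀ {A B} (f : Hom A B) → re f top ≡ top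
    re-∧    : ∀ {A B} (f : Hom A B) (α β : Fib B) → re f (α ∧ β) ≡ (re f α ∧ re f β)
    elem    : ∀ {X A} (α : Fib (X ⊗ A)) (β : Fib (X ⊗ (A ⊗ A))) →
              (exE α ≤ β) ⇔ (α ≤ re (id ×₁ Δ) β)
    ex-adj  : ∀ {X A} (α : Fib (X ⊗ A)) (β : Fib A) → (Ex α ≤ β) ⇔ (α ≤ re π₂ β)
    ex₁-adj : ∀ {X A} (α : Fib (X ⊗ A)) (β : Fib X) → (Ex₁ α ≤ β) ⇔ (α ≤ re π₁ β)
    ex-BC   : ∀ {X A B} (f : Hom B A) (α : Fib (X ⊗ A)) →
              re f (Ex α) ≡ Ex (re (id ×₁ f) α)
    ex₁-BC  : ∀ {X A B} (f : Hom B X) (α : Fib (X ⊗ A)) →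
              re f (Ex₁ α) ≡ Ex₁ (re (f ×₁ id) α)
    ex-Frob  : ∀ {X A} (α : Fib (X ⊗ A)) (β : Fib A) →
               Ex (α ∧ re π₂ β) ≡ (Ex α ∧ β)
    ex₁-Frob : ∀ {X A} (α : Fib (X ⊗ A)) (β : Fib X) →
               Ex₁ (α ∧ re π₁ β) ≡ (Ex₁ α ∧ β)

record FunctorData {o m p o' m' p'} (D : Doctrine o m p) (E : Doctrine o' m' p')
       : Set (o ⊔ m ⊔ o' ⊔ m') where
  private
    module D = Doctrine D
    module E = Doctrine E
  field
    Fo : D.Obj → E.Obj
    Fh : ∀ {A B} → D.Hom A B → E.Hom (Fo A) (Fo B)

record IsEEDMor {o m p o' m' p'} (D : Doctrine o m p) (E : Doctrine o' m' p')
       (F : FunctorData D E) (b : ∀ A → Doctrine.Fib D A → Doctrine.Fib E (FunctorData.Fo F A))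
       : Set (o ⊔ m ⊔ p ⊔ o' ⊔ m' ⊔ p') where
  private
    module D = Doctrine D
    module E = Doctrine E
  open FunctorData F
  field
    F-id   : ∀ {A} → Fh (D.id {A}) E.≈ E.id
    F-⨾    : ∀ {A B C} (f : D.Hom A B) (g : D.Hom B C) → Fh (f D.⨾ g) E.≈ (Fh f E.⨾ Fh g)
    F-resp : ∀ {A B} {f g : D.Hom A B} → f D.≈ g → Fh f E.≈ Fh g
    F-⊗    : ∀ A B → Fo (A D.⊗ B) ≡ (Fo A E.⊗ Fo B)
    F-𝟙    : Fo D.𝟙 ≡ E.𝟙
    F-π₁   : ∀ {A B} → subst (λ Z → E.Hom Z (Fo A)) (F-⊗ A B) (Fh (D.π₁ {A} {B})) E.≈ E.π₁
    F-π₂   : ∀ {A B} → subst (λ Z → E.Hom Z (Fo B)) (F-⊗ A B) (Fh (D.π₂ {A} {B})) E.≈ E.π₂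
    F-⟨⟩   : ∀ {C A B} (f : D.Hom C A) (g : D.Hom C B) →
             subst (E.Hom (Fo C)) (F-⊗ A B) (Fh D.⟨ f , g ⟩) E.≈ E.⟨ Fh f , Fh g ⟩
    F-!    : ∀ {A} → subst (E.Hom (Fo A)) F-𝟙 (Fh (D.! {A})) E.≈ E.!
    b-top  : ∀ {A} → b A D.top ≡ E.top
    b-∧    : ∀ {A} (α β : D.Fib A) → b A (α D.∧ β) ≡ (b A α E.∧ b A β)
    b-nat  : ∀ {A B} (f : D.Hom A B) (α : D.Fib B) → b A (D.re f α) ≡ E.re (Fh f) (b B α)
    b-δ    : ∀ A → subst E.Fib (F-⊗ A A) (b (A D.⊗ A) (D.δ A)) ≡ E.δ (Fo A)
    b-∃    : ∀ {X A} (α : D.Fib (X D.⊗ A)) →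
             b A (D.Ex α) ≡ E.Ex (subst E.Fib (F-⊗ X A) (b (X D.⊗ A) α))

-- The cartesian bicategory A_P = L(P) (relational structure), and the
-- doctrine RL(P) = Hom_{A_P}(-, I) = P(- × I).

module AP {o m p} (D : Doctrine o m p) where
  open Doctrine D

  -- composite in A_P: ∃_{⟨π1,π3⟩}(P_{⟨π1,π2⟩} f ∧ P_{⟨π2,π3⟩} g), with the
  -- middle variable Y placed first so that ⟨π1,π3⟩ is the projection
  -- π₂ : Y × (X × Z) → X × Z.
  _⨟_ : ∀ {X Y Z} → Fib (X ⊗ Y) → Fib (Y ⊗ Z) → Fib (X ⊗ Z)
  f ⨟ g = Ex (re ⟨ π₂ ⨾ π₁ , π₁ ⟩ f ∧ re ⟨ π₁ , π₂ ⨾ π₂ ⟩ g)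

  _⊠_ : ∀ {X X' Y Y'} → Fib (X ⊗ Y) → Fib (X' ⊗ Y') → Fib ((X ⊗ X') ⊗ (Y ⊗ Y'))
  f ⊠ g = re ⟨ π₁ ⨾ π₁ , π₂ ⨾ π₁ ⟩ f ∧ re ⟨ π₁ ⨾ π₂ , π₂ ⨾ π₂ ⟩ g

  -- converse (right adjoint of maps; used for d^*, e^*, f^*)
  conv : ∀ {X Y} → Fib (X ⊗ Y) → Fib (Y ⊗ X)
  conv r = re ⟨ π₂ , π₁ ⟩ r

  Γ : ∀ {X Y} → Hom X Y → Fib (X ⊗ Y)
  Γ {X} {Y} f = re (f ×₁ id) (δ Y)

  dᴬ : ∀ X → Fib (X ⊗ (X ⊗ X))
  dᴬ X = Γ Δ

  eᴬ : ∀ X → Fib (X ⊗ 𝟙)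
  eᴬ X = Γ (! {X})

  IsMap : ∀ {X Y} → Fib (X ⊗ Y) → Set p
  IsMap {X} {Y} r = ((r ⨟ dᴬ Y) ≡ (dᴬ X ⨟ (r ⊠ r))) × ((r ⨟ eᴬ Y) ≡ eᴬ X)

  -- cartesian structure of Map(A_P): π₁ = (id ⊗ e);ρ, π₂ = (e ⊗ id);λ,
  -- ⟨f,g⟩ = d;(f ⊗ g), ! = e, with unitors transported along Γ.
  π₁ᴬ : ∀ {X Y} → Fib ((X ⊗ Y) ⊗ X)
  π₁ᴬ {X} {Y} = (δ X ⊠ eᴬ Y) ⨟ Γ (π₁ {X} {𝟙})

  π₂ᴬ : ∀ {X Y} → Fib ((X ⊗ Y) ⊗ Y)
  π₂ᴬ {X} {Y} = (eᴬ X ⊠ δ Y) ⨟ Γ (π₂ {𝟙} {Y})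

  pairᴬ : ∀ {C X Y} → Fib (C ⊗ X) → Fib (C ⊗ Y) → Fib (C ⊗ (X ⊗ Y))
  pairᴬ {C} f g = dᴬ C ⨟ (f ⊠ g)

  -- RL(P) as doctrine data over (the maps of) A_P.
  -- Base homs are the relations of A_P; being a map is the predicate IsMap.
  RL : Doctrine o p p
  RL = record
    { Obj   = Obj
    ; Hom   = λ X Y → Fib (X ⊗ Y)
    ; _≈_   = _≡_
    ; id    = λ {A} → δ A
    ; _⨾_   = _⨟_
    ; _⊗_   = _⊗_
    ; 𝟙     = 𝟙
    ; π₁    = π₁ᴬ
    ; π₂    = π₂ᴬ
    ; ⟨_,_⟩ = pairᴬ
    ; !     = λ {A} → eᴬ A
    ; Fib   = λ X → Fib (X ⊗ 𝟙)
    ; _≤_   = _≤_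
    ; top   = top
    ; _∧_   = _∧_
    ; re    = λ r U → r ⨟ U
    ; δ     = λ A → conv (dᴬ A) ⨟ eᴬ A
    ; Ex    = λ U → conv π₂ᴬ ⨟ U
    ; Ex₁   = λ U → conv π₁ᴬ ⨟ U
    }

  ηF : FunctorData D RL
  ηF = record { Fo = λ X → X ; Fh = Γ }

  ηb : ∀ A → Fib A → Fib (A ⊗ 𝟙)
  ηb A α = re ρ α

-- The action of RL on a morphism (F , b) : P → R, through L(F,b)(r) = b(r)
-- (transported along the strictness equalities of F).

module RLmor {o m p} (P R : Doctrine o m p) (F : FunctorData P R)
  (b : ∀ A → Doctrine.Fib P A → Doctrine.Fib R (FunctorData.Fo F A))
  (mor : IsEEDMor P R F b) where
  private
    module P = Doctrine P
    module R = Doctrine R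
  open FunctorData F
  open IsEEDMor mor

  Lhom : ∀ {X Y} → P.Fib (X P.⊗ Y) → R.Fib (Fo X R.⊗ Fo Y)
  Lhom {X} {Y} r = subst R.Fib (F-⊗ X Y) (b (X P.⊗ Y) r)

  Lfib : ∀ {X} → P.Fib (X P.⊗ P.𝟙) → R.Fib (Fo X R.⊗ R.𝟙)
  Lfib {X} U = subst (λ Z → R.Fib (Fo X R.⊗ Z)) F-𝟙 (Lhom U)

-- Everything rests on three consequences of the axioms of an elementary
-- existential doctrine: Leibniz' rule for δ, the one-point rule for ∃,
-- and δ_{A×B} = δ_A ∧ δ_B.  The one-point rule turns composition with a
-- graph into reindexing, Γ f ; s = P_{f×id} s, from which Γ is a strict
-- cartesian functor into the maps of A_P and Pρ commutes with
-- reindexing, δ and ∃.  Naturality only uses that b commutes with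
-- reindexing and preserves δ, once the strictness equations of F are
-- transported away.

module Submission where

open import Defs
open import Level using (Level; _⊔_)
open import Relation.Binary.PropositionalEquality
  using (_≡_; refl; sym; trans; cong; cong₂; subst; isEquivalence; module ≡-Reasoning)
open import Relation.Binary.Bundles using (Poset)
import Relation.Binary.Reasoning.PartialOrder as PartialOrderReasoning
open import Data.Product using (_×_; _,_; proj₁; proj₂)

-- Equations between composites of identities, projections, pairings,
-- ! and arbitrary atomic arrows [ f ∶ B ] are decided by normalisation
-- by evaluation into η-long normal forms of the free cartesian category.
module CartesianReflection {o m p} (D : Doctrine o m p) (E : IsEED D) where
  open Doctrine D
  open IsEED E

  ⨾-⟨⟩ : ∀ {C D' A B} (h : Hom D' C) (f : Hom C A) (g : Hom C B) →
         (h ⨾ ⟨ f , g ⟩) ≈ ⟨ h ⨾ f , h ⨾ g ⟩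
  ⨾-⟨⟩ h f g = ≈-trans (≈-sym (η× (h ⨾ ⟨ f , g ⟩)))
    (⟨⟩-cong (≈-trans (assoc h ⟨ f , g ⟩ π₁) (⨾-cong ≈-refl (β₁ f g)))
             (≈-trans (assoc h ⟨ f , g ⟩ π₂) (⨾-cong ≈-refl (β₂ f g))))

  infixr 7 _`⊗_
  data Ty : Set o where
    `b   : Obj → Ty
    _`⊗_ : Ty → Ty → Ty
    `𝟙   : Ty

  ⟦_⟧ : Ty → Obj
  ⟦ `b X ⟧   = X
  ⟦ A `⊗ B ⟧ = ⟦ A ⟧ ⊗ ⟦ B ⟧
  ⟦ `𝟙 ⟧     = 𝟙

  infixr 9 _`⨾_
  data Tm : Ty → Ty → Set (o ⊔ m) where
    `id    : ∀ {A} → Tm A A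
    _`⨾_   : ∀ {A B C} → Tm A B → Tm B C → Tm A C
    `π₁    : ∀ {A B} → Tm (A `⊗ B) A
    `π₂    : ∀ {A B} → Tm (A `⊗ B) B
    `⟨_,_⟩ : ∀ {C A B} → Tm C A → Tm C B → Tm C (A `⊗ B)
    `!     : ∀ {A} → Tm A `𝟙
    atom   : ∀ {A} (B : Ty) → Hom ⟦ A ⟧ ⟦ B ⟧ → Tm A B

  syntax atom B f = `[ f ∶ B ]

  _`×_ : ∀ {A B C D'} → Tm A C → Tm B D' → Tm (A `⊗ B) (C `⊗ D')
  t `× u = `⟨ `π₁ `⨾ t , `π₂ `⨾ u ⟩

  `Δ : ∀ {A} → Tm A (A `⊗ A)
  `Δ = `⟨ `id , `id ⟩

  ⟦_⟧t : ∀ {A B} → Tm A B → Hom ⟦ A ⟧ ⟦ B ⟧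
  ⟦ `id ⟧t          = id
  ⟦ t `⨾ u ⟧t       = ⟦ t ⟧t ⨾ ⟦ u ⟧t
  ⟦ `π₁ ⟧t          = π₁
  ⟦ `π₂ ⟧t          = π₂
  ⟦ `⟨ t , u ⟩ ⟧t   = ⟨ ⟦ t ⟧t , ⟦ u ⟧t ⟩
  ⟦ `! ⟧t           = !
  ⟦ `[ f ∶ B ] ⟧t   = f

  data Ne (Γ : Ty) : Ty → Set (o ⊔ m)
  data Nf (Γ : Ty) : Ty → Set (o ⊔ m)
  data Ne Γ where
    var : Ne Γ Γ
    fst : ∀ {A B} → Ne Γ (A `⊗ B) → Ne Γ A
    snd : ∀ {A B} → Ne Γ (A `⊗ B) → Ne Γ B
    app : ∀ {A B} → Hom ⟦ A ⟧ ⟦ B ⟧ → Nf Γ A → Ne Γ B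
  data Nf Γ where
    ne   : ∀ {X} → Ne Γ (`b X) → Nf Γ (`b X)
    pair : ∀ {A B} → Nf Γ A → Nf Γ B → Nf Γ (A `⊗ B)
    unit : Nf Γ `𝟙

  ⟦_⟧ne : ∀ {Γ A} → Ne Γ A → Hom ⟦ Γ ⟧ ⟦ A ⟧
  ⟦_⟧nf : ∀ {Γ A} → Nf Γ A → Hom ⟦ Γ ⟧ ⟦ A ⟧
  ⟦ var ⟧ne      = id
  ⟦ fst n ⟧ne    = ⟦ n ⟧ne ⨾ π₁
  ⟦ snd n ⟧ne    = ⟦ n ⟧ne ⨾ π₂
  ⟦ app f n ⟧ne  = ⟦ n ⟧nf ⨾ f
  ⟦ ne n ⟧nf     = ⟦ n ⟧ne
  ⟦ pair a b ⟧nf = ⟨ ⟦ a ⟧nf , ⟦ b ⟧nf ⟩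
  ⟦ unit ⟧nf     = !

  reflect : ∀ {Γ} A → Ne Γ A → Nf Γ A
  reflect (`b X) n   = ne n
  reflect (A `⊗ B) n = pair (reflect A (fst n)) (reflect B (snd n))
  reflect `𝟙 n       = unit

  fstNf : ∀ {Γ A B} → Nf Γ (A `⊗ B) → Nf Γ A
  fstNf (pair a b) = a

  sndNf : ∀ {Γ A B} → Nf Γ (A `⊗ B) → Nf Γ B
  sndNf (pair a b) = b

  eval : ∀ {Γ A B} → Tm A B → Nf Γ A → Nf Γ B
  eval `id n            = n
  eval (t `⨾ u) n       = eval u (eval t n)
  eval `π₁ n            = fstNf n
  eval `π₂ n            = sndNf n
  eval `⟨ t , u ⟩ n     = pair (eval t n) (eval u n)
  eval `! n             = unit
  eval `[ f ∶ B ] n     = reflect B (app f n)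

  nf : ∀ {A B} → Tm A B → Nf A B
  nf {A} t = eval t (reflect A var)

  reflect-sound : ∀ {Γ} A (n : Ne Γ A) → ⟦ reflect A n ⟧nf ≈ ⟦ n ⟧ne
  reflect-sound (`b X) n   = ≈-refl
  reflect-sound (A `⊗ B) n =
    ≈-trans (⟨⟩-cong (reflect-sound A (fst n)) (reflect-sound B (snd n))) (η× _)
  reflect-sound `𝟙 n       = ≈-sym (!-unique _)

  fstNf-sound : ∀ {Γ A B} (n : Nf Γ (A `⊗ B)) → ⟦ fstNf n ⟧nf ≈ (⟦ n ⟧nf ⨾ π₁)
  fstNf-sound (pair a b) = ≈-sym (β₁ _ _)

  sndNf-sound : ∀ {Γ A B} (n : Nf Γ (A `⊗ B)) → ⟦ sndNf n ⟧nf ≈ (⟦ n ⟧nf ⨾ π₂)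
  sndNf-sound (pair a b) = ≈-sym (β₂ _ _)

  eval-sound : ∀ {Γ A B} (t : Tm A B) (n : Nf Γ A) → ⟦ eval t n ⟧nf ≈ (⟦ n ⟧nf ⨾ ⟦ t ⟧t)
  eval-sound `id n          = ≈-sym (idʳ _)
  eval-sound (t `⨾ u) n     =
    ≈-trans (eval-sound u (eval t n)) (≈-trans (⨾-cong (eval-sound t n) ≈-refl) (assoc _ _ _))
  eval-sound `π₁ n          = fstNf-sound n
  eval-sound `π₂ n          = sndNf-sound n
  eval-sound `⟨ t , u ⟩ n   =
    ≈-trans (⟨⟩-cong (eval-sound t n) (eval-sound u n)) (≈-sym (⨾-⟨⟩ _ _ _))
  eval-sound `! n           = ≈-sym (!-unique _)
  eval-sound `[ f ∶ B ] n   = reflect-sound B (app f n)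

  nf-sound : ∀ {A B} (t : Tm A B) → ⟦ nf t ⟧nf ≈ ⟦ t ⟧t
  nf-sound {A} t =
    ≈-trans (eval-sound t (reflect A var)) (≈-trans (⨾-cong (reflect-sound A var) ≈-refl) (idˡ _))

  solve : ∀ {A B} (t u : Tm A B) → nf t ≡ nf u → ⟦ t ⟧t ≈ ⟦ u ⟧t
  solve t u nf-t≡nf-u =
    ≈-trans (≈-sym (nf-sound t))
      (≈-trans (subst (λ n → ⟦ nf t ⟧nf ≈ ⟦ n ⟧nf) nf-t≡nf-u ≈-refl) (nf-sound u))

module ElementaryExistential {o m p} (D : Doctrine o m p) (E : IsEED D) where
  open Doctrine D
  open IsEED E
  open CartesianReflection D E public

  fibrePoset : Obj → Poset p p p
  fibrePoset A = record
    { Carrier        = Fib A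
    ; _≈_            = _≡_
    ; _≤_            = _≤_
    ; isPartialOrder = record
      { isPreorder = record
        { isEquivalence = isEquivalence
        ; reflexive     = λ { refl → ≤-refl }
        ; trans         = ≤-trans
        }
      ; antisym    = ≤-antisym
      }
    }

  module ≤-Reasoning {A : Obj} = PartialOrderReasoning (fibrePoset A)
  open ≤-Reasoning

  ≡⇒≤ : ∀ {A} {α β : Fib A} → α ≡ β → α ≤ β
  ≡⇒≤ refl = ≤-refl

  ∧-introˡ-valid : ∀ {A} {α β : Fib A} → top ≤ β → α ≤ (β ∧ α)
  ∧-introˡ-valid top≤β = ∧-glb (≤-trans (top-max _) top≤β) ≤-refl

  ∧-mono : ∀ {A} {α α' β β' : Fib A} → α ≤ α' → β ≤ β' → (α ∧ β) ≤ (α' ∧ β')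
  ∧-mono α≤α' β≤β' = ∧-glb (≤-trans (∧-lb₁ _ _) α≤α') (≤-trans (∧-lb₂ _ _) β≤β')

  ∧-identityʳ : ∀ {A} (α : Fib A) → (α ∧ top) ≡ α
  ∧-identityʳ α = ≤-antisym (∧-lb₁ _ _) (∧-glb ≤-refl (top-max _))

  re-mono : ∀ {A B} (f : Hom A B) {α β : Fib B} → α ≤ β → re f α ≤ re f β
  re-mono f {α} {β} α≤β = begin
    re f α             ≡⟨ cong (re f) (≤-antisym (∧-glb ≤-refl α≤β) (∧-lb₁ _ _)) ⟩
    re f (α ∧ β)       ≡⟨ re-∧ f α β ⟩
    re f α ∧ re f β    ≤⟨ ∧-lb₂ _ _ ⟩
    re f β             ∎

  re-⨾-≈ : ∀ {A B C} {f : Hom A B} {g : Hom B C} {h : Hom A C} {α : Fib C} →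
           (f ⨾ g) ≈ h → re f (re g α) ≡ re h α
  re-⨾-≈ {f = f} {g} {α = α} f⨾g≈h = trans (sym (re-⨾ f g α)) (re-resp f⨾g≈h α)

  Ex-elim : ∀ {X A} {α : Fib (X ⊗ A)} {β : Fib A} → α ≤ re π₂ β → Ex α ≤ β
  Ex-elim {α = α} {β} = proj₂ (ex-adj α β)

  Ex-unit : ∀ {X A} (α : Fib (X ⊗ A)) → α ≤ re π₂ (Ex α)
  Ex-unit α = proj₁ (ex-adj α (Ex α)) ≤-refl

  Ex-intro : ∀ {C X Z} (γ : Fib (X ⊗ Z)) (w : Hom C X) (z : Hom C Z) →
             re ⟨ w , z ⟩ γ ≤ re z (Ex γ)
  Ex-intro γ w z = ≤-trans (re-mono ⟨ w , z ⟩ (Ex-unit γ)) (≡⇒≤ (re-⨾-≈ (β₂ w z)))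

  δ-refl : ∀ {C A} (f : Hom C A) → top ≤ re ⟨ f , f ⟩ (δ A)
  δ-refl {C} {A} f = begin
    top                                                        ≡⟨ re-top ⟨ ! , f ⟩ ⟨
    re ⟨ ! , f ⟩ top                                           ≤⟨ re-mono ⟨ ! , f ⟩ valid-on-diagonal ⟩
    re ⟨ ! , f ⟩ (re (id ×₁ Δ) (re ⟨ π₂ ⨾ π₁ , π₂ ⨾ π₂ ⟩ (δ A)))
      ≡⟨ cong (re ⟨ ! , f ⟩) (re-⨾-≈ (solve {`𝟙 `⊗ `b A}
           ((`id `× `Δ) `⨾ `⟨ `π₂ `⨾ `π₁ , `π₂ `⨾ `π₂ ⟩) `⟨ `π₂ , `π₂ ⟩ refl)) ⟩
    re ⟨ ! , f ⟩ (re ⟨ π₂ , π₂ ⟩ (δ A))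
      ≡⟨ re-⨾-≈ (solve {`b C} (`⟨ `! , F ⟩ `⨾ `⟨ `π₂ , `π₂ ⟩) `⟨ F , F ⟩ refl) ⟩
    re ⟨ f , f ⟩ (δ A)                                         ∎
    where
    F = `[ f ∶ `b A ]
    -- the unit of ∃_e ⊣ P_e at ⊤, since ∃_e ⊤ is a meet with δ
    valid-on-diagonal : top ≤ re (id {𝟙} ×₁ Δ) (re ⟨ π₂ ⨾ π₁ , π₂ ⨾ π₂ ⟩ (δ A))
    valid-on-diagonal =
      ≤-trans (proj₁ (elem top (exE top)) ≤-refl) (re-mono (id ×₁ Δ) (∧-lb₂ _ _))

  δ-refl-⨾ : ∀ {C B A} {h : Hom C B} {k : Hom B (A ⊗ A)} (f : Hom C A) →
             (h ⨾ k) ≈ ⟨ f , f ⟩ → top ≤ re h (re k (δ A))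
  δ-refl-⨾ f h⨾k≈⟨f,f⟩ = ≤-trans (δ-refl f) (≡⇒≤ (sym (re-⨾-≈ h⨾k≈⟨f,f⟩)))

  δ-subst : ∀ {C A} (f g : Hom C A) (ψ : Fib (C ⊗ A)) →
            (re ⟨ id , f ⟩ ψ ∧ re ⟨ f , g ⟩ (δ A)) ≤ re ⟨ id , g ⟩ ψ
  δ-subst {C} {A} f g ψ = begin
    re ⟨ id , f ⟩ ψ ∧ re ⟨ f , g ⟩ (δ A)
      ≡⟨ cong₂ _∧_ (re-⨾-≈ (solve {c} (K `⨾ `⟨ `π₁ , `π₂ `⨾ `π₁ ⟩) `⟨ `id , F ⟩ refl))
                   (re-⨾-≈ (solve {c} (K `⨾ `⟨ `π₂ `⨾ `π₁ , `π₂ `⨾ `π₂ ⟩) `⟨ F , G ⟩ refl)) ⟨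
    re k (re ⟨ π₁ , π₂ ⨾ π₁ ⟩ ψ) ∧ re k (re ⟨ π₂ ⨾ π₁ , π₂ ⨾ π₂ ⟩ (δ A))
      ≡⟨ re-∧ k _ _ ⟨
    re k (exE ψ)
      ≤⟨ re-mono k (proj₂ (elem ψ β) (≡⇒≤ (sym β-on-diagonal))) ⟩
    re k β
      ≡⟨ re-⨾-≈ (solve {c} (K `⨾ `⟨ `π₁ , `π₂ `⨾ `π₂ ⟩) `⟨ `id , G ⟩ refl) ⟩
    re ⟨ id , g ⟩ ψ ∎
    where
    c = `b C
    F = `[ f ∶ `b A ]
    G = `[ g ∶ `b A ]
    K = `⟨ `id , `⟨ F , G ⟩ ⟩
    k = ⟨ id , ⟨ f , g ⟩ ⟩
    β = re ⟨ π₁ , π₂ ⨾ π₂ ⟩ ψ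
    β-on-diagonal : re (id ×₁ Δ) β ≡ ψ
    β-on-diagonal =
      trans (re-⨾-≈ (solve {c `⊗ `b A} ((`id `× `Δ) `⨾ `⟨ `π₁ , `π₂ `⨾ `π₂ ⟩) `id refl)) (re-id ψ)

  δ-sym-≤ : ∀ {C A} (f g : Hom C A) → re ⟨ f , g ⟩ (δ A) ≤ re ⟨ g , f ⟩ (δ A)
  δ-sym-≤ {C} {A} f g = begin
    re ⟨ f , g ⟩ (δ A)
      ≤⟨ ∧-introˡ-valid (δ-refl-⨾ f (solve {`b C} (`⟨ `id , F ⟩ `⨾ `⟨ `π₂ , `π₁ `⨾ F ⟩) `⟨ F , F ⟩ refl)) ⟩
    re ⟨ id , f ⟩ ψ ∧ re ⟨ f , g ⟩ (δ A)
      ≤⟨ δ-subst f g ψ ⟩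
    re ⟨ id , g ⟩ ψ
      ≡⟨ re-⨾-≈ (solve {`b C} (`⟨ `id , G ⟩ `⨾ `⟨ `π₂ , `π₁ `⨾ F ⟩) `⟨ G , F ⟩ refl) ⟩
    re ⟨ g , f ⟩ (δ A) ∎
    where
    F = `[ f ∶ `b A ]
    G = `[ g ∶ `b A ]
    ψ = re ⟨ π₂ , π₁ ⨾ f ⟩ (δ A)

  δ-sym : ∀ {C A} (f g : Hom C A) → re ⟨ f , g ⟩ (δ A) ≡ re ⟨ g , f ⟩ (δ A)
  δ-sym f g = ≤-antisym (δ-sym-≤ f g) (δ-sym-≤ g f)

  Ex-one-point : ∀ {A Z} (g : Hom Z A) (ψ : Fib (A ⊗ Z)) →
                 Ex (re ⟨ π₂ ⨾ g , π₁ ⟩ (δ A) ∧ ψ) ≡ re ⟨ g , id ⟩ ψ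
  Ex-one-point {A} {Z} g ψ = ≤-antisym (Ex-elim body≤) ≤Ex-body
    where
    a = `b A
    z = `b Z
    G = `[ g ∶ a ]
    body = re ⟨ π₂ ⨾ g , π₁ ⟩ (δ A) ∧ ψ
    ψ' = re ⟨ π₂ , π₁ ⨾ π₂ ⟩ ψ
    body≤ : body ≤ re π₂ (re ⟨ g , id ⟩ ψ)
    body≤ = begin
      body
        ≤⟨ ∧-glb (≤-trans (∧-lb₂ _ _) (≡⇒≤ (sym (trans
             (re-⨾-≈ (solve {a `⊗ z} (`⟨ `id , `π₁ ⟩ `⨾ `⟨ `π₂ , `π₁ `⨾ `π₂ ⟩) `id refl)) (re-id ψ)))))
           (≤-trans (∧-lb₁ _ _) (δ-sym-≤ (π₂ ⨾ g) π₁)) ⟩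
      re ⟨ id , π₁ ⟩ ψ' ∧ re ⟨ π₁ , π₂ ⨾ g ⟩ (δ A)
        ≤⟨ δ-subst π₁ (π₂ ⨾ g) ψ' ⟩
      re ⟨ id , π₂ ⨾ g ⟩ ψ'
        ≡⟨ re-⨾-≈ (solve {a `⊗ z} (`⟨ `id , `π₂ `⨾ G ⟩ `⨾ `⟨ `π₂ , `π₁ `⨾ `π₂ ⟩) (`π₂ `⨾ `⟨ G , `id ⟩) refl) ⟩
      re (π₂ ⨾ ⟨ g , id ⟩) ψ
        ≡⟨ re-⨾ π₂ ⟨ g , id ⟩ ψ ⟩
      re π₂ (re ⟨ g , id ⟩ ψ) ∎
    ≤Ex-body : re ⟨ g , id ⟩ ψ ≤ Ex body
    ≤Ex-body = begin
      re ⟨ g , id ⟩ ψ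
        ≤⟨ ∧-introˡ-valid (δ-refl-⨾ g (solve {z} (`⟨ G , `id ⟩ `⨾ `⟨ `π₂ `⨾ G , `π₁ ⟩) `⟨ G , G ⟩ refl)) ⟩
      re ⟨ g , id ⟩ (re ⟨ π₂ ⨾ g , π₁ ⟩ (δ A)) ∧ re ⟨ g , id ⟩ ψ
        ≡⟨ re-∧ ⟨ g , id ⟩ _ _ ⟨
      re ⟨ g , id ⟩ body
        ≤⟨ Ex-intro body g id ⟩
      re id (Ex body)
        ≡⟨ re-id _ ⟩
      Ex body ∎

  δ-≤-re-× : ∀ {Y X} (h : Hom Y X) → δ Y ≤ re (h ×₁ h) (δ X)
  δ-≤-re-× {Y} {X} h = begin
    δ Y
      ≡⟨ trans (re-resp (solve {y `⊗ y} `⟨ `π₁ , `π₂ ⟩ `id refl) (δ Y)) (re-id _) ⟨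
    re ⟨ π₁ , π₂ ⟩ (δ Y)
      ≤⟨ ∧-introˡ-valid (δ-refl-⨾ (π₁ ⨾ h)
           (solve {y `⊗ y} (`⟨ `id , `π₁ ⟩ `⨾ `⟨ `π₁ `⨾ `π₁ `⨾ H , `π₂ `⨾ H ⟩) `⟨ `π₁ `⨾ H , `π₁ `⨾ H ⟩ refl)) ⟩
    re ⟨ id , π₁ ⟩ ψ ∧ re ⟨ π₁ , π₂ ⟩ (δ Y)
      ≤⟨ δ-subst π₁ π₂ ψ ⟩
    re ⟨ id , π₂ ⟩ ψ
      ≡⟨ re-⨾-≈ (solve {y `⊗ y} (`⟨ `id , `π₂ ⟩ `⨾ `⟨ `π₁ `⨾ `π₁ `⨾ H , `π₂ `⨾ H ⟩) (H `× H) refl) ⟩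
    re (h ×₁ h) (δ X) ∎
    where
    y = `b Y
    H = `[ h ∶ `b X ]
    ψ = re ⟨ π₁ ⨾ π₁ ⨾ h , π₂ ⨾ h ⟩ (δ X)

  δ-⊗ : ∀ A B → δ (A ⊗ B) ≡ (re ⟨ π₁ ⨾ π₁ , π₂ ⨾ π₁ ⟩ (δ A) ∧ re ⟨ π₁ ⨾ π₂ , π₂ ⨾ π₂ ⟩ (δ B))
  δ-⊗ A B = ≤-antisym (∧-glb (δ-≤-re-× π₁) (δ-≤-re-× π₂)) δA∧δB≤
    where
    c = (`b A `⊗ `b B) `⊗ (`b A `⊗ `b B)
    δA = re ⟨ π₁ ⨾ π₁ , π₂ ⨾ π₁ ⟩ (δ A)
    δB = re ⟨ π₁ ⨾ π₂ , π₂ ⨾ π₂ ⟩ (δ B)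
    ψ₁ = re ⟨ π₁ ⨾ π₁ , ⟨ π₂ , π₁ ⨾ π₁ ⨾ π₂ ⟩ ⟩ (δ (A ⊗ B))
    ψ₂ = re ⟨ π₁ ⨾ π₁ , ⟨ π₁ ⨾ π₂ ⨾ π₁ , π₂ ⟩ ⟩ (δ (A ⊗ B))
    -- rewrite the first components with δA, then the second ones with δB
    δA∧δB≤ : (δA ∧ δB) ≤ δ (A ⊗ B)
    δA∧δB≤ = begin
      δA ∧ δB
        ≤⟨ ∧-mono (∧-introˡ-valid (δ-refl-⨾ π₁
             (solve {c} (`⟨ `id , `π₁ `⨾ `π₁ ⟩ `⨾ `⟨ `π₁ `⨾ `π₁ , `⟨ `π₂ , `π₁ `⨾ `π₁ `⨾ `π₂ ⟩ ⟩)
                        `⟨ `π₁ , `π₁ ⟩ refl))) ≤-refl ⟩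
      (re ⟨ id , π₁ ⨾ π₁ ⟩ ψ₁ ∧ δA) ∧ δB
        ≤⟨ ∧-mono (δ-subst (π₁ ⨾ π₁) (π₂ ⨾ π₁) ψ₁) ≤-refl ⟩
      re ⟨ id , π₂ ⨾ π₁ ⟩ ψ₁ ∧ δB
        ≡⟨ cong (_∧ δB) (re-⨾-≈
             (solve {c} (`⟨ `id , `π₂ `⨾ `π₁ ⟩ `⨾ `⟨ `π₁ `⨾ `π₁ , `⟨ `π₂ , `π₁ `⨾ `π₁ `⨾ `π₂ ⟩ ⟩)
                        `⟨ `π₁ , `⟨ `π₂ `⨾ `π₁ , `π₁ `⨾ `π₂ ⟩ ⟩ refl)) ⟩
      re ⟨ π₁ , ⟨ π₂ ⨾ π₁ , π₁ ⨾ π₂ ⟩ ⟩ (δ (A ⊗ B)) ∧ δB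
        ≡⟨ cong (_∧ δB) (re-⨾-≈
             (solve {c} (`⟨ `id , `π₁ `⨾ `π₂ ⟩ `⨾ `⟨ `π₁ `⨾ `π₁ , `⟨ `π₁ `⨾ `π₂ `⨾ `π₁ , `π₂ ⟩ ⟩)
                        `⟨ `π₁ , `⟨ `π₂ `⨾ `π₁ , `π₁ `⨾ `π₂ ⟩ ⟩ refl)) ⟨
      re ⟨ id , π₁ ⨾ π₂ ⟩ ψ₂ ∧ δB
        ≤⟨ δ-subst (π₁ ⨾ π₂) (π₂ ⨾ π₂) ψ₂ ⟩
      re ⟨ id , π₂ ⨾ π₂ ⟩ ψ₂
        ≡⟨ re-⨾-≈ (solve {c} (`⟨ `id , `π₂ `⨾ `π₂ ⟩ `⨾ `⟨ `π₁ `⨾ `π₁ , `⟨ `π₁ `⨾ `π₂ `⨾ `π₁ , `π₂ ⟩ ⟩)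
                             `id refl) ⟩
      re id (δ (A ⊗ B))
        ≡⟨ re-id _ ⟩
      δ (A ⊗ B) ∎

  δ-𝟙 : δ 𝟙 ≡ top
  δ-𝟙 = ≤-antisym (top-max _) (begin
    top                  ≤⟨ δ-refl π₁ ⟩
    re ⟨ π₁ , π₁ ⟩ (δ 𝟙) ≡⟨ re-resp (solve {`𝟙 `⊗ `𝟙} `⟨ `π₁ , `π₁ ⟩ `id refl) _ ⟩
    re id (δ 𝟙)          ≡⟨ re-id _ ⟩
    δ 𝟙                  ∎)

  re-⨾³-≈ : ∀ {A B C D'} {f : Hom A B} {g : Hom B C} {h : Hom C D'} {k : Hom A D'} {α : Fib D'} →
            (f ⨾ g ⨾ h) ≈ k → re f (re g (re h α)) ≡ re k α
  re-⨾³-≈ {f = f} {g} {h} {α = α} f⨾g⨾h≈k = trans (cong (re f) (sym (re-⨾ g h α))) (re-⨾-≈ f⨾g⨾h≈k)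

  Ex-one-point-⊗ : ∀ {X A} (α : Fib (X ⊗ A)) →
                   Ex (re ⟨ π₁ ⨾ π₂ , π₂ ⨾ π₁ ⟩ (δ A) ∧ re (π₁ {X ⊗ A} {A ⊗ 𝟙}) α) ≡ Ex (re (id ×₁ π₁) α)
  Ex-one-point-⊗ {X} {A} α = ≤-antisym (Ex-elim body≤) (Ex-elim γ≤)
    where
    x = `b X
    a = `b A
    c = (x `⊗ a) `⊗ (a `⊗ `𝟙)
    body = re ⟨ π₁ ⨾ π₂ , π₂ ⨾ π₁ ⟩ (δ A) ∧ re (π₁ {X ⊗ A} {A ⊗ 𝟙}) α
    γ = re (id ×₁ π₁) α
    ψ = re ⟨ π₁ ⨾ π₁ ⨾ π₁ , π₂ ⟩ α
    w = ⟨ π₁ , π₂ ⨾ π₁ ⟩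
    body≤ : body ≤ re π₂ (Ex γ)
    body≤ = begin
      body
        ≤⟨ ∧-glb (≤-trans (∧-lb₂ _ _) (≡⇒≤ (sym (re-⨾-≈
             (solve {c} (`⟨ `id , `π₁ `⨾ `π₂ ⟩ `⨾ `⟨ `π₁ `⨾ `π₁ `⨾ `π₁ , `π₂ ⟩) `π₁ refl)))))
           (∧-lb₁ _ _) ⟩
      re ⟨ id , π₁ ⨾ π₂ ⟩ ψ ∧ re ⟨ π₁ ⨾ π₂ , π₂ ⨾ π₁ ⟩ (δ A)
        ≤⟨ δ-subst _ _ ψ ⟩
      re ⟨ id , π₂ ⨾ π₁ ⟩ ψ
        ≡⟨ re-⨾-≈ (solve {c} (`⟨ `id , `π₂ `⨾ `π₁ ⟩ `⨾ `⟨ `π₁ `⨾ `π₁ `⨾ `π₁ , `π₂ ⟩)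
                             (`⟨ `π₁ `⨾ `π₁ , `π₂ ⟩ `⨾ (`id `× `π₁)) refl) ⟩
      re (⟨ π₁ ⨾ π₁ , π₂ ⟩ ⨾ (id ×₁ π₁)) α
        ≡⟨ re-⨾ _ _ α ⟩
      re ⟨ π₁ ⨾ π₁ , π₂ ⟩ γ
        ≤⟨ Ex-intro γ _ _ ⟩
      re π₂ (Ex γ) ∎
    γ≤ : γ ≤ re π₂ (Ex body)
    γ≤ = begin
      γ
        ≡⟨ re-resp (solve {x `⊗ (a `⊗ `𝟙)} (`id `× `π₁) (`⟨ `⟨ `π₁ , `π₂ `⨾ `π₁ ⟩ , `π₂ ⟩ `⨾ `π₁) refl) α ⟩
      re (⟨ w , π₂ ⟩ ⨾ π₁) α
        ≡⟨ re-⨾ _ _ α ⟩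
      re ⟨ w , π₂ ⟩ (re π₁ α)
        ≤⟨ ∧-introˡ-valid (δ-refl-⨾ (π₂ ⨾ π₁)
             (solve {x `⊗ (a `⊗ `𝟙)} (`⟨ `⟨ `π₁ , `π₂ `⨾ `π₁ ⟩ , `π₂ ⟩ `⨾ `⟨ `π₁ `⨾ `π₂ , `π₂ `⨾ `π₁ ⟩)
                                     `⟨ `π₂ `⨾ `π₁ , `π₂ `⨾ `π₁ ⟩ refl)) ⟩
      re ⟨ w , π₂ ⟩ (re ⟨ π₁ ⨾ π₂ , π₂ ⨾ π₁ ⟩ (δ A)) ∧ re ⟨ w , π₂ ⟩ (re π₁ α)
        ≡⟨ re-∧ _ _ _ ⟨
      re ⟨ w , π₂ ⟩ body
        ≤⟨ Ex-intro body _ _ ⟩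
      re π₂ (Ex body) ∎

module GraphFunctor {o m p} (D : Doctrine o m p) (E : IsEED D) where
  open Doctrine D
  open IsEED E
  open ElementaryExistential D E
  open AP D
  open ≡-Reasoning

  -- an instance of the one-point rule
  Γ-⨟ : ∀ {X Y Z} (f : Hom X Y) (s : Fib (Y ⊗ Z)) → (Γ f ⨟ s) ≡ re (f ×₁ id) s
  Γ-⨟ {X} {Y} {Z} f s = begin
    Ex (re ⟨ π₂ ⨾ π₁ , π₁ ⟩ (re (f ×₁ id) (δ Y)) ∧ re ⟨ π₁ , π₂ ⨾ π₂ ⟩ s)
      ≡⟨ cong (λ φ → Ex (φ ∧ re ⟨ π₁ , π₂ ⨾ π₂ ⟩ s)) (re-⨾-≈
           (solve {y `⊗ (x `⊗ z)} (`⟨ `π₂ `⨾ `π₁ , `π₁ ⟩ `⨾ (F `× `id)) `⟨ `π₂ `⨾ (`π₁ `⨾ F) , `π₁ ⟩ refl)) ⟩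
    Ex (re ⟨ π₂ ⨾ (π₁ ⨾ f) , π₁ ⟩ (δ Y) ∧ re ⟨ π₁ , π₂ ⨾ π₂ ⟩ s)
      ≡⟨ Ex-one-point (π₁ ⨾ f) _ ⟩
    re ⟨ π₁ ⨾ f , id ⟩ (re ⟨ π₁ , π₂ ⨾ π₂ ⟩ s)
      ≡⟨ re-⨾-≈ (solve {x `⊗ z} (`⟨ `π₁ `⨾ F , `id ⟩ `⨾ `⟨ `π₁ , `π₂ `⨾ `π₂ ⟩) (F `× `id) refl) ⟩
    re (f ×₁ id) s ∎
    where
    x = `b X
    y = `b Y
    z = `b Z
    F = `[ f ∶ y ]

  Γ-resp : ∀ {A B} {f g : Hom A B} → f ≈ g → Γ f ≡ Γ g
  Γ-resp f≈g = re-resp (⟨⟩-cong (⨾-cong ≈-refl f≈g) ≈-refl) _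

  Γ-id : ∀ {A} → Γ (id {A}) ≡ δ A
  Γ-id {A} = trans (re-resp (solve {`b A `⊗ `b A} (`id `× `id) `id refl) _) (re-id _)

  Γ-⨾ : ∀ {X Y Z} (f : Hom X Y) (g : Hom Y Z) → Γ (f ⨾ g) ≡ (Γ f ⨟ Γ g)
  Γ-⨾ {X} {Y} {Z} f g = begin
    Γ (f ⨾ g)                        ≡⟨ re-⨾-≈ (solve {`b X `⊗ `b Z} ((F `× `id) `⨾ (G `× `id)) ((F `⨾ G) `× `id) refl) ⟨
    re (f ×₁ id) (re (g ×₁ id) (δ Z)) ≡⟨ Γ-⨟ f (Γ g) ⟨
    Γ f ⨟ Γ g                        ∎
    where
    F = `[ f ∶ `b Y ]
    G = `[ g ∶ `b Z ]

  Γ-⊠ : ∀ {X X' Y Y'} (f : Hom X Y) (g : Hom X' Y') → (Γ f ⊠ Γ g) ≡ Γ (f ×₁ g)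
  Γ-⊠ {X} {X'} {Y} {Y'} f g = sym (begin
    re ((f ×₁ g) ×₁ id) (δ (Y ⊗ Y'))
      ≡⟨ cong (re ((f ×₁ g) ×₁ id)) (δ-⊗ Y Y') ⟩
    re ((f ×₁ g) ×₁ id) (re ⟨ π₁ ⨾ π₁ , π₂ ⨾ π₁ ⟩ (δ Y) ∧ re ⟨ π₁ ⨾ π₂ , π₂ ⨾ π₂ ⟩ (δ Y'))
      ≡⟨ re-∧ _ _ _ ⟩
    re ((f ×₁ g) ×₁ id) (re ⟨ π₁ ⨾ π₁ , π₂ ⨾ π₁ ⟩ (δ Y)) ∧ re ((f ×₁ g) ×₁ id) (re ⟨ π₁ ⨾ π₂ , π₂ ⨾ π₂ ⟩ (δ Y'))
      ≡⟨ cong₂ _∧_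
           (trans (re-⨾-≈ (solve {c} (((F `× G) `× `id) `⨾ `⟨ `π₁ `⨾ `π₁ , `π₂ `⨾ `π₁ ⟩)
                                     (`⟨ `π₁ `⨾ `π₁ , `π₂ `⨾ `π₁ ⟩ `⨾ (F `× `id)) refl)) (re-⨾ _ _ _))
           (trans (re-⨾-≈ (solve {c} (((F `× G) `× `id) `⨾ `⟨ `π₁ `⨾ `π₂ , `π₂ `⨾ `π₂ ⟩)
                                     (`⟨ `π₁ `⨾ `π₂ , `π₂ `⨾ `π₂ ⟩ `⨾ (G `× `id)) refl)) (re-⨾ _ _ _)) ⟩
    Γ f ⊠ Γ g ∎)
    where
    c = (`b X `⊗ `b X') `⊗ (`b Y `⊗ `b Y')
    F = `[ f ∶ `b Y ]
    G = `[ g ∶ `b Y' ]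

  eᴬ≡top : ∀ X → eᴬ X ≡ top
  eᴬ≡top X = trans (cong (re (! ×₁ id)) δ-𝟙) (re-top _)

  Γ-π₁ : ∀ {X Y} → Γ (π₁ {X} {Y}) ≡ π₁ᴬ
  Γ-π₁ {X} {Y} = sym (begin
    (δ X ⊠ eᴬ Y) ⨟ Γ π₁       ≡⟨ cong (λ r → (r ⊠ eᴬ Y) ⨟ Γ π₁) Γ-id ⟨
    (Γ id ⊠ Γ !) ⨟ Γ π₁       ≡⟨ cong (_⨟ Γ π₁) (Γ-⊠ id !) ⟩
    Γ (id ×₁ !) ⨟ Γ π₁        ≡⟨ Γ-⨾ _ _ ⟨
    Γ ((id ×₁ !) ⨾ π₁)        ≡⟨ Γ-resp (solve {`b X `⊗ `b Y} ((`id `× `!) `⨾ `π₁) `π₁ refl) ⟩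
    Γ π₁                      ∎)

  Γ-π₂ : ∀ {X Y} → Γ (π₂ {X} {Y}) ≡ π₂ᴬ
  Γ-π₂ {X} {Y} = sym (begin
    (eᴬ X ⊠ δ Y) ⨟ Γ π₂       ≡⟨ cong (λ r → (eᴬ X ⊠ r) ⨟ Γ π₂) Γ-id ⟨
    (Γ ! ⊠ Γ id) ⨟ Γ π₂       ≡⟨ cong (_⨟ Γ π₂) (Γ-⊠ ! id) ⟩
    Γ (! ×₁ id) ⨟ Γ π₂        ≡⟨ Γ-⨾ _ _ ⟨
    Γ ((! ×₁ id) ⨾ π₂)        ≡⟨ Γ-resp (solve {`b X `⊗ `b Y} ((`! `× `id) `⨾ `π₂) `π₂ refl) ⟩
    Γ π₂                      ∎)

  Γ-⟨⟩ : ∀ {C A B} (f : Hom C A) (g : Hom C B) → Γ ⟨ f , g ⟩ ≡ pairᴬ (Γ f) (Γ g)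
  Γ-⟨⟩ {C} {A} {B} f g = sym (begin
    Γ Δ ⨟ (Γ f ⊠ Γ g)         ≡⟨ cong (Γ Δ ⨟_) (Γ-⊠ f g) ⟩
    Γ Δ ⨟ Γ (f ×₁ g)          ≡⟨ Γ-⨾ _ _ ⟨
    Γ (Δ ⨾ (f ×₁ g))          ≡⟨ Γ-resp (solve {`b C} (`Δ `⨾ (F `× G)) `⟨ F , G ⟩ refl) ⟩
    Γ ⟨ f , g ⟩               ∎)
    where
    F = `[ f ∶ `b A ]
    G = `[ g ∶ `b B ]

  Γ-isMap : ∀ {X Y} (f : Hom X Y) → IsMap (Γ f)
  Γ-isMap {X} {Y} f = Γf-comultiplicative , Γf-counital
    where
    F = `[ f ∶ `b Y ]
    Γf-comultiplicative : (Γ f ⨟ dᴬ Y) ≡ (dᴬ X ⨟ (Γ f ⊠ Γ f))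
    Γf-comultiplicative = begin
      Γ f ⨟ Γ Δ                ≡⟨ Γ-⨾ f Δ ⟨
      Γ (f ⨾ Δ)                ≡⟨ Γ-resp (solve {`b X} (F `⨾ `Δ) `⟨ F , F ⟩ refl) ⟩
      Γ ⟨ f , f ⟩              ≡⟨ Γ-⟨⟩ f f ⟩
      Γ Δ ⨟ (Γ f ⊠ Γ f)        ∎
    Γf-counital : (Γ f ⨟ eᴬ Y) ≡ eᴬ X
    Γf-counital = trans (sym (Γ-⨾ f !)) (Γ-resp (solve {`b X} (F `⨾ `!) `! refl))

  ηb-natural : ∀ {A B} (f : Hom A B) (α : Fib B) → ηb A (re f α) ≡ (Γ f ⨟ ηb B α)
  ηb-natural {A} {B} f α = begin
    re π₁ (re f α)             ≡⟨ re-⨾ _ _ α ⟨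
    re (π₁ ⨾ f) α              ≡⟨ re-⨾-≈ (solve {`b A `⊗ `𝟙} ((F `× `id) `⨾ `π₁) (`π₁ `⨾ F) refl) ⟨
    re (f ×₁ id) (re π₁ α)     ≡⟨ Γ-⨟ f _ ⟨
    Γ f ⨟ re π₁ α              ∎
    where
    F = `[ f ∶ `b B ]

  ηb-δ : ∀ A → ηb (A ⊗ A) (δ A) ≡ (conv (dᴬ A) ⨟ eᴬ A)
  ηb-δ A = sym (begin
    Ex (re ⟨ π₂ ⨾ π₁ , π₁ ⟩ (re ⟨ π₂ , π₁ ⟩ (re (Δ ×₁ id) (δ (A ⊗ A)))) ∧ re ⟨ π₁ , π₂ ⨾ π₂ ⟩ (eᴬ A))
      ≡⟨ cong₂ (λ φ χ → Ex (φ ∧ χ)) (trans (re-⨾³-≈ ≈-refl) (cong (re M) (δ-⊗ A A)))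
                                   (trans (cong (re _) (eᴬ≡top A)) (re-top _)) ⟩
    Ex (re M (re ⟨ π₁ ⨾ π₁ , π₂ ⨾ π₁ ⟩ (δ A) ∧ re ⟨ π₁ ⨾ π₂ , π₂ ⨾ π₂ ⟩ (δ A)) ∧ top)
      ≡⟨ cong Ex (trans (∧-identityʳ _) (re-∧ _ _ _)) ⟩
    Ex (re M (re ⟨ π₁ ⨾ π₁ , π₂ ⨾ π₁ ⟩ (δ A)) ∧ re M (re ⟨ π₁ ⨾ π₂ , π₂ ⨾ π₂ ⟩ (δ A)))
      ≡⟨ cong₂ (λ φ χ → Ex (φ ∧ χ))
           (trans (re-⨾-≈ (solve {c} (TM `⨾ `⟨ `π₁ `⨾ `π₁ , `π₂ `⨾ `π₁ ⟩) `⟨ `π₁ , `π₂ `⨾ `π₁ `⨾ `π₁ ⟩ refl))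
                  (δ-sym _ _))
           (re-⨾-≈ (solve {c} (TM `⨾ `⟨ `π₁ `⨾ `π₂ , `π₂ `⨾ `π₂ ⟩) `⟨ `π₁ , `π₂ `⨾ `π₁ `⨾ `π₂ ⟩ refl)) ⟩
    Ex (re ⟨ π₂ ⨾ (π₁ ⨾ π₁) , π₁ ⟩ (δ A) ∧ re ⟨ π₁ , π₂ ⨾ π₁ ⨾ π₂ ⟩ (δ A))
      ≡⟨ Ex-one-point (π₁ ⨾ π₁) _ ⟩
    re ⟨ π₁ ⨾ π₁ , id ⟩ (re ⟨ π₁ , π₂ ⨾ π₁ ⨾ π₂ ⟩ (δ A))
      ≡⟨ re-⨾-≈ (solve {(a `⊗ a) `⊗ `𝟙} (`⟨ `π₁ `⨾ `π₁ , `id ⟩ `⨾ `⟨ `π₁ , `π₂ `⨾ `π₁ `⨾ `π₂ ⟩) `π₁ refl) ⟩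
    re π₁ (δ A) ∎)
    where
    a = `b A
    c = a `⊗ ((a `⊗ a) `⊗ `𝟙)
    M = ⟨ π₂ ⨾ π₁ , π₁ ⟩ ⨾ ⟨ π₂ , π₁ ⟩ ⨾ (Δ ×₁ id)
    TM : Tm c ((a `⊗ a) `⊗ (a `⊗ a))
    TM = `⟨ `π₂ `⨾ `π₁ , `π₁ ⟩ `⨾ `⟨ `π₂ , `π₁ ⟩ `⨾ (`Δ `× `id)

  ηb-Ex : ∀ {X A} (α : Fib (X ⊗ A)) → ηb A (Ex α) ≡ (conv π₂ᴬ ⨟ ηb (X ⊗ A) α)
  ηb-Ex {X} {A} α = sym (begin
    conv π₂ᴬ ⨟ re π₁ α
      ≡⟨ cong (λ r → conv r ⨟ re π₁ α) Γ-π₂ ⟨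
    Ex (re ⟨ π₂ ⨾ π₁ , π₁ ⟩ (re ⟨ π₂ , π₁ ⟩ (re (π₂ ×₁ id) (δ A))) ∧ re ⟨ π₁ , π₂ ⨾ π₂ ⟩ (re π₁ α))
      ≡⟨ cong₂ (λ φ χ → Ex (φ ∧ χ))
           (re-⨾³-≈ (solve {c} (`⟨ `π₂ `⨾ `π₁ , `π₁ ⟩ `⨾ `⟨ `π₂ , `π₁ ⟩ `⨾ (`π₂ `× `id))
                               `⟨ `π₁ `⨾ `π₂ , `π₂ `⨾ `π₁ ⟩ refl))
           (re-⨾-≈ (solve {c} (`⟨ `π₁ , `π₂ `⨾ `π₂ ⟩ `⨾ `π₁) `π₁ refl)) ⟩
    Ex (re ⟨ π₁ ⨾ π₂ , π₂ ⨾ π₁ ⟩ (δ A) ∧ re π₁ α)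
      ≡⟨ Ex-one-point-⊗ α ⟩
    Ex (re (id ×₁ π₁) α)
      ≡⟨ ex-BC π₁ α ⟨
    re π₁ (Ex α) ∎)
    where
    c = (`b X `⊗ `b A) `⊗ (`b A `⊗ `𝟙)

  η-isEEDMor : IsEEDMor D RL ηF ηb
  η-isEEDMor = record
    { F-id   = Γ-id
    ; F-⨾    = Γ-⨾
    ; F-resp = Γ-resp
    ; F-⊗    = λ _ _ → refl
    ; F-𝟙    = refl
    ; F-π₁   = Γ-π₁
    ; F-π₂   = Γ-π₂
    ; F-⟨⟩   = Γ-⟨⟩
    ; F-!    = refl
    ; b-top  = re-top _
    ; b-∧    = re-∧ _
    ; b-nat  = ηb-natural
    ; b-δ    = ηb-δ
    ; b-∃    = ηb-Ex
    }

module Transport {o m p} (R : Doctrine o m p) (ER : IsEED R) where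
  open Doctrine R
  open IsEED ER

  subst-dom : ∀ {Z Z' W} → Z ≡ Z' → Hom Z W → Hom Z' W
  subst-dom {W = W} = subst (λ V → Hom V W)

  subst-re : ∀ {Z Z' W W'} (e₁ : Z ≡ Z') (e₂ : W ≡ W') (h : Hom Z W) (β : Fib W) →
             subst Fib e₁ (re h β) ≡ re (subst-dom e₁ (subst (Hom Z) e₂ h)) (subst Fib e₂ β)
  subst-re refl refl h β = refl

  subst-dom-≈ : ∀ {Z Z' W} (e : Z ≡ Z') {h h' : Hom Z W} → h ≈ h' → subst-dom e h ≈ subst-dom e h'
  subst-dom-≈ refl h≈h' = h≈h'

  subst-dom-⟨⟩ : ∀ {Z Z' A B} (e : Z ≡ Z') (u : Hom Z A) (v : Hom Z B) →
                 subst-dom e ⟨ u , v ⟩ ≈ ⟨ subst-dom e u , subst-dom e v ⟩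
  subst-dom-⟨⟩ refl u v = ≈-refl

  subst-dom-⨾ : ∀ {Z Z' A B} (e : Z ≡ Z') (u : Hom Z A) (v : Hom A B) →
                subst-dom e (u ⨾ v) ≈ (subst-dom e u ⨾ v)
  subst-dom-⨾ refl u v = ≈-refl

  subst-re-π₁ : ∀ {A U V} (e : U ≡ V) (β : Fib A) →
                subst (λ Z → Fib (A ⊗ Z)) e (re (π₁ {A} {U}) β) ≡ re π₁ β
  subst-re-π₁ refl β = refl

module Naturality {o m p} (P R : Doctrine o m p) (ER : IsEED R)
  (F : FunctorData P R)
  (b : ∀ A → Doctrine.Fib P A → Doctrine.Fib R (FunctorData.Fo F A))
  (mor : IsEEDMor P R F b) where
  private
    module P = Doctrine P
    module R = Doctrine R
  open IsEED ER
  open FunctorData F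
  open IsEEDMor mor
  open Transport R ER
  open RLmor P R F b mor
  open ≡-Reasoning

  F-×₁-id : ∀ {X Y} (f : P.Hom X Y) →
            subst-dom (F-⊗ X Y) (subst (R.Hom _) (F-⊗ Y Y) (Fh (f P.×₁ P.id))) R.≈ (Fh f R.×₁ R.id)
  F-×₁-id {X} {Y} f =
    ≈-trans (subst-dom-≈ e (F-⟨⟩ _ _)) (≈-trans (subst-dom-⟨⟩ e _ _) (⟨⟩-cong
      (≈-trans (subst-dom-≈ e (F-⨾ _ _)) (≈-trans (subst-dom-⨾ e _ _) (⨾-cong F-π₁ ≈-refl)))
      (≈-trans (subst-dom-≈ e (F-⨾ _ _)) (≈-trans (subst-dom-⨾ e _ _) (⨾-cong F-π₂ F-id)))))
    where
    e = F-⊗ X Y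

  Lhom-Γ : ∀ {X Y} (f : P.Hom X Y) → Lhom (AP.Γ P f) ≡ AP.Γ R (Fh f)
  Lhom-Γ {X} {Y} f = begin
    subst R.Fib (F-⊗ X Y) (b (X P.⊗ Y) (P.re (f P.×₁ P.id) (P.δ Y)))
      ≡⟨ cong (subst R.Fib (F-⊗ X Y)) (b-nat (f P.×₁ P.id) (P.δ Y)) ⟩
    subst R.Fib (F-⊗ X Y) (R.re (Fh (f P.×₁ P.id)) (b (Y P.⊗ Y) (P.δ Y)))
      ≡⟨ subst-re (F-⊗ X Y) (F-⊗ Y Y) _ _ ⟩
    R.re (subst-dom (F-⊗ X Y) (subst (R.Hom _) (F-⊗ Y Y) (Fh (f P.×₁ P.id))))
         (subst R.Fib (F-⊗ Y Y) (b (Y P.⊗ Y) (P.δ Y)))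
      ≡⟨ cong (R.re _) (b-δ Y) ⟩
    R.re (subst-dom (F-⊗ X Y) (subst (R.Hom _) (F-⊗ Y Y) (Fh (f P.×₁ P.id)))) (R.δ (Fo Y))
      ≡⟨ re-resp (F-×₁-id f) _ ⟩
    R.re (Fh f R.×₁ R.id) (R.δ (Fo Y)) ∎

  Lfib-ηb : ∀ X (α : P.Fib X) → Lfib (AP.ηb P X α) ≡ AP.ηb R (Fo X) (b X α)
  Lfib-ηb X α = begin
    subst (λ Z → R.Fib (Fo X R.⊗ Z)) F-𝟙 (subst R.Fib (F-⊗ X P.𝟙) (b (X P.⊗ P.𝟙) (P.re P.π₁ α)))
      ≡⟨ cong (λ β → subst (λ Z → R.Fib (Fo X R.⊗ Z)) F-𝟙 (subst R.Fib (F-⊗ X P.𝟙) β)) (b-nat P.π₁ α) ⟩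
    subst (λ Z → R.Fib (Fo X R.⊗ Z)) F-𝟙 (subst R.Fib (F-⊗ X P.𝟙) (R.re (Fh P.π₁) (b X α)))
      ≡⟨ cong (subst (λ Z → R.Fib (Fo X R.⊗ Z)) F-𝟙)
              (trans (subst-re (F-⊗ X P.𝟙) refl _ _) (re-resp F-π₁ _)) ⟩
    subst (λ Z → R.Fib (Fo X R.⊗ Z)) F-𝟙 (R.re R.π₁ (b X α))
      ≡⟨ subst-re-π₁ F-𝟙 _ ⟩
    R.re R.π₁ (b X α) ∎

lemmaC1 : ∀ {o m p : Level} →
    -- components: η_P = (Γ_P , Pρ) is a morphism of EED  P → RL(P),
    -- with Γ_P landing in Map(A_P)
    ((P : Doctrine o m p) → IsEED P →
        (∀ {X Y} (f : Doctrine.Hom P X Y) → AP.IsMap P (AP.Γ P f))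
      × IsEEDMor P (AP.RL P) (AP.ηF P) (AP.ηb P))
    ×
    -- naturality: RL(F,b) ∘ η_P = η_R ∘ (F,b) for every (F,b) : P → R in EED
    ((P R : Doctrine o m p) → IsEED P → IsEED R →
     (F : FunctorData P R)
     (b : ∀ A → Doctrine.Fib P A → Doctrine.Fib R (FunctorData.Fo F A)) →
     (mor : IsEEDMor P R F b) →
        (∀ {X Y} (f : Doctrine.Hom P X Y) →
           RLmor.Lhom P R F b mor (AP.Γ P f) ≡ AP.Γ R (FunctorData.Fh F f))
      × (∀ X (α : Doctrine.Fib P X) →
           RLmor.Lfib P R F b mor (AP.ηb P X α) ≡ AP.ηb R (FunctorData.Fo F X) (b X α)))
lemmaC1 =
  (λ P EP → GraphFunctor.Γ-isMap P EP , GraphFunctor.η-isEEDMor P EP) ,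
  (λ P R _ ER F b mor → Naturality.Lhom-Γ P R ER F b mor , Naturality.Lfib-ηb P R ER F b mor)
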